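{- Let $n\in\mathbb{N}$, fix car lengths $\mathbf{y}=(y_1,y_2,\ldots,y_n)\in\mathbb{N}^n$ and a permutation $\sigma=\sigma_1\sigma_2\cdots\sigma_n\in\mathfrak{S}_n$. Then the number of parking sequences $\mathbf{x}$ for $\mathbf{y}$ whose outcome is $\sigma$ is \[|\mathcal{O}_{\mathsf{PS}_n(\mathbf{y})}^{ -1}(\sigma)|=\prod_{i=1}^n\left(1+\sum_{k\in L(\mathbf{y},\sigma_i)}y_k\right),\] where $L(\mathbf{y},\sigma_i)=\emptyset$ if $i=1$ or if $\sigma_{i-1}>\sigma_i$, and otherwise $L(\mathbf{y},\sigma_i)=\{\sigma_t,\sigma_{t+1},\ldots,\sigma_{i-1}\}$, where $\sigma_t\sigma_{t+1}\cdots\sigma_i$ is the longest contiguous subword of $\sigma$ ending at position $i$ such that $\sigma_k<\sigma_i$ for all $t\le k<i$.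
   Context: Parking sequences: there are $n$ cars $1,\ldots,n$ of lengths $y_1,\ldots,y_n\in\mathbb{N}$ and $m=\sum_{i=1}^n y_i$ parking spots labeled $1,\ldots,m$ along a one-way street. A preference list is $\mathbf{x}=(x_1,\ldots,x_n)\in[m]^n$, $x_i$ being the preferred spot of car $i$. Cars enter in the order $1,2,\ldots,n$; car $i$ finds the first empty spot $j\ge x_i$; if spots $j,j+1,\ldots,j+y_i-1$ are all empty it parks there (occupying them), and otherwise (spot $j$ empty but one of $j+1,\ldots,j+y_i-1$ occupied, or no such $j$ exists/fits) a collision occurs and the car fails to park. $\mathbf{x}$ is a parking sequence for $\mathbf{y}$ if all cars park; $\mathsf{PS}_n(\mathbf{y})$ denotes the set of these. For $\mathbf{x}\in\mathsf{PS}_n(\mathbf{y})$, the outcome $\mathcal{O}_{\mathsf{PS}_n(\mathbf{y})}(\mathbf{x})=\sigma_1\cdots\sigma_n\in\mathfrak{S}_n$ is the permutation (in one-line notation) with $\sigma_j=i$ meaning car $i$ is the $j$th car from the left on the street after parking. $\mathcal{O}_{\mathsf{PS}_n(\mathbf{y})}^{ -1}(\sigma)=\{\mathbf{x}\in\mathsf{PS}_n(\mathbf{y}):\mathcal{O}_{\mathsf{PS}_n(\mathbf{y})}(\mathbf{x})=\sigma\}$. -}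

module Defs where

open import Data.Nat using (ℕ; zero; suc; _+_)
open import Data.Nat.ListAction using (sum; product)
open import Data.Fin using (Fin; toℕ; _<?_)
open import Data.Fin.Permutation using (Permutation′; _⟨$⟩ʳ_)
open import Data.Fin.Properties as FinP using ()
open import Data.List using (List; []; _∷_; map; concatMap; replicate; take; reverse; takeWhile; filter; length; foldl)
open import Data.List.Base using (allFin)
import Data.List.Properties as ListP
open import Data.Maybe using (Maybe; just; nothing; _>>=_)
import Data.Maybe as Maybe
import Data.Maybe.Properties as MaybeP
open import Data.Vec using (Vec; lookup; tabulate; toList) renaming ([] to []ᵥ; _∷_ to _∷ᵥ_)
open import Relation.Binary.PropositionalEquality using (_≡_)
open import Relation.Nullary using (Dec; yes; no)

-- Street: list of spots (spot j is index j, 0-based), each empty (nothing)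
-- or occupied by a car label.
Street : ℕ → Set
Street n = List (Maybe (Fin n))

fill : ∀ {n} → ℕ → Fin n → Street n → Maybe (Street n)
fill zero    c s              = just s
fill (suc ℓ) c []             = nothing
fill (suc ℓ) c (just _ ∷ s)   = nothing
fill (suc ℓ) c (nothing ∷ s)  = Maybe.map (just c ∷_) (fill ℓ c s)

-- Car c of length ℓ with preferred spot p (0-based): go to the first
-- empty spot j ≥ p; park at j..j+ℓ-1 if all empty, otherwise fail
-- (also fail if no empty spot j ≥ p exists).
parkCar : ∀ {n} → ℕ → ℕ → Fin n → Street n → Maybe (Street n)
parkCar (suc p) ℓ c []            = nothing
parkCar (suc p) ℓ c (o ∷ s)       = Maybe.map (o ∷_) (parkCar p ℓ c s)
parkCar zero    ℓ c []            = nothing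
parkCar zero    ℓ c (just a ∷ s)  = Maybe.map (just a ∷_) (parkCar zero ℓ c s)
parkCar zero    ℓ c (nothing ∷ s) = fill ℓ c (nothing ∷ s)

spots : ∀ {n} → (Fin n → ℕ) → ℕ
spots {n} y = sum (map y (allFin n))

-- Cars 1..n (here Fin n, in increasing order) park in order.
parkAll : ∀ {n} (y : Fin n → ℕ) → Vec (Fin (spots y)) n → Maybe (Street n)
parkAll {n} y x =
  foldl (λ ms i → ms >>= parkCar (toℕ (lookup x i)) (y i) i)
        (just (replicate (spots y) nothing)) (allFin n)

-- Read the final street left to right, listing each car once
-- (each car occupies a contiguous block, so dropping repeats suffices).
compress : ∀ {n} → Maybe (Fin n) → Street n → List (Fin n)
compress prev []              = []
compress prev (nothing ∷ s)   = compress nothing s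
compress nothing (just c ∷ s) = c ∷ compress (just c) s
compress (just d) (just c ∷ s) with FinP._≟_ d c
... | yes _ = compress (just c) s
... | no  _ = c ∷ compress (just c) s

-- Outcome (as the one-line word σ_1 ⋯ σ_n); nothing if some car fails to park,
-- i.e. if x is not a parking sequence for y.
outcome : ∀ {n} (y : Fin n → ℕ) → Vec (Fin (spots y)) n → Maybe (List (Fin n))
outcome y x = Maybe.map (compress nothing) (parkAll y x)

allVecs : (m n : ℕ) → List (Vec (Fin m) n)
allVecs m zero    = []ᵥ ∷ []
allVecs m (suc n) = concatMap (λ f → map (f ∷ᵥ_) (allVecs m n)) (allFin m)

-- one-line notation of σ: position j ↦ σ_j
word : ∀ {n} → Permutation′ n → List (Fin n)
word {n} σ = toList (tabulate (σ ⟨$⟩ʳ_))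

fiberSize : ∀ {n} (y : Fin n → ℕ) → Permutation′ n → ℕ
fiberSize {n} y σ =
  length (filter (λ x → MaybeP.≡-dec (ListP.≡-dec FinP._≟_) (outcome y x) (just (word σ)))
                 (allVecs (spots y) n))

-- L(y, σ_i) as a list of cars: σ_{i-1}, σ_{i-2}, …, going left while σ_k < σ_i
-- (empty if i is the first position or σ_{i-1} > σ_i).
L : ∀ {n} → Permutation′ n → Fin n → List (Fin n)
L σ i = takeWhile (λ k → k <? (σ ⟨$⟩ʳ i)) (reverse (take (toℕ i) (word σ)))

productFormula : ∀ {n} (y : Fin n → ℕ) → Permutation′ n → ℕ
productFormula {n} y σ = product (map (λ i → 1 + sum (map y (L σ i))) (allFin n))

-- Lay the slots of the cars out in the order σ. For the outcome to be σ, the street just before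
-- car c parks must be the stage in which the cars smaller than c occupy their slots and every other
-- slot is empty. From there c lands in its own slot exactly when its preferred spot is the first
-- spot of that slot or lies in the maximal run of occupied spots ending right before it; that run
-- is made of the cars of L(y, c), giving 1 + Σ_{k ∈ L(y, c)} y_k choices, independently for each car.
-- Conversely, if the outcome is σ, counting occupied spots shows that the final street is the full
-- σ-layout, and since every intermediate street extends to the final one, each car must have
-- parked into its own slot.

module Submission where

open import Defs
open import Level using (Level)
open import Data.Bool using (Bool; true; false; _∧_; if_then_else_)
open import Data.Bool.Properties using (∧-identityʳ; ∧-zeroʳ)
open import Data.Empty using (⊥-elim)
open import Data.Fin using (Fin; toℕ; zero; suc; _<?_)
import Data.Fin.Properties as FinP
open import Data.Fin.Permutation using (Permutation′; _⟨$⟩ʳ_; _⟨$⟩ˡ_; inverseʳ; flip)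
open import Data.List
  using (List; []; _∷_; _++_; map; concatMap; replicate; take; drop; reverse; takeWhile; filter;
         length; foldl; tabulate; head; allFin)
import Data.List.Properties as LP
open import Data.List.Membership.Propositional using (_∈_)
open import Data.List.Relation.Unary.All as All using (All; []; _∷_)
import Data.List.Relation.Unary.All.Properties as AllP
open import Data.List.Relation.Unary.Any using (here; there)
open import Data.List.Relation.Unary.Unique.Propositional using (Unique)
open import Data.List.Relation.Unary.AllPairs using ([]; _∷_)
import Data.List.Relation.Unary.Unique.Propositional.Properties as UniqueP
open import Data.Maybe using (Maybe; just; nothing; _>>=_)
import Data.Maybe as Maybe
open import Data.Maybe.Properties as MaybeP using (just-injective)
open import Data.Nat as ℕ using (ℕ; zero; suc; _+_; _*_; _≤_; _<_; _≮_; z≤n; s≤s)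
open import Data.Nat.ListAction using (sum; product)
open import Data.Nat.Properties
  using (+-assoc; +-comm; +-suc; +-identityʳ; +-cancelˡ-≡; +-cancelʳ-≡; *-distribʳ-+; suc-injective; 0≢1+n;
         m+n≡0⇒n≡0; ≤-refl; ≤-trans; ≤-reflexive; <-≤-trans; <-irrefl; m≤m+n; m≤n+m; m<m+n; m<n⇒m<1+n;
         ≤-pred; ≤∧≢⇒<; +-monoʳ-≤; +-0-commutativeMonoid; *-1-commutativeMonoid; module ≤-Reasoning)
open import Data.Nat.Tactic.RingSolver using (solve-∀)
open import Data.Product using (∃; ∃₂; _×_; _,_; proj₁; proj₂)
open import Data.Vec as Vec using (Vec; lookup) renaming ([] to []ᵥ; _∷_ to _∷ᵥ_)
import Algebra.Properties.CommutativeMonoid.Sum as CommutativeMonoidSum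
open import Function using (_∘_; id; _⇔_; mk⇔)
open import Function.Properties.Inverse using (Inverse⇒Injection)
open import Function.Bundles using (Injection; Equivalence)
open import Relation.Binary.Definitions using (DecidableEquality)
open import Relation.Binary.PropositionalEquality
  using (_≡_; _≢_; refl; sym; trans; cong; cong₂; subst; subst₂; _≗_; ≢-sym; module ≡-Reasoning)
open import Relation.Nullary using (Dec; yes; no; does; ¬_)
open import Relation.Nullary.Decidable using (dec-true; dec-false; decidable-stable)
open import Relation.Unary using (Pred; Decidable)

private variable
  a p : Level
  X Y : Set a
  n m k : ℕ

indicator : Bool → ℕ
indicator true  = 1
indicator false = 0

count : (X → Bool) → List X → ℕ
count P []       = 0
count P (x ∷ xs) = indicator (P x) + count P xs

count-++ : ∀ (P : X → Bool) xs ys → count P (xs ++ ys) ≡ count P xs + count P ys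
count-++ P []       ys = refl
count-++ P (x ∷ xs) ys =
  trans (cong (indicator (P x) +_) (count-++ P xs ys)) (sym (+-assoc (indicator (P x)) _ _))

count-cong : ∀ {P Q : X → Bool} → P ≗ Q → count P ≗ count Q
count-cong P≗Q []       = refl
count-cong P≗Q (x ∷ xs) = cong₂ _+_ (cong indicator (P≗Q x)) (count-cong P≗Q xs)

count-map : ∀ (P : Y → Bool) (f : X → Y) xs → count P (map f xs) ≡ count (P ∘ f) xs
count-map P f []       = refl
count-map P f (x ∷ xs) = cong (indicator (P (f x)) +_) (count-map P f xs)

count-false : ∀ {P : X → Bool} → (∀ x → P x ≡ false) → ∀ xs → count P xs ≡ 0
count-false P≡false []       = refl
count-false P≡false (x ∷ xs) rewrite P≡false x = count-false P≡false xs

count-∧ˡ : ∀ b (P : X → Bool) xs → count (λ x → b ∧ P x) xs ≡ indicator b * count P xs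
count-∧ˡ true  P xs = sym (+-identityʳ (count P xs))
count-∧ˡ false P xs = count-false (λ _ → refl) xs

length-filter≡count : ∀ {P : Pred X p} (P? : Decidable P) xs →
                      length (filter P? xs) ≡ count (does ∘ P?) xs
length-filter≡count P? []       = refl
length-filter≡count P? (x ∷ xs) with does (P? x)
... | true  = cong suc (length-filter≡count P? xs)
... | false = length-filter≡count P? xs

does-⇔ : ∀ {P : Set p} (P? : Dec P) {b} → P ⇔ (b ≡ true) → does P? ≡ b
does-⇔ (yes P)  {b}     P⇔b = sym (Equivalence.to P⇔b P)
does-⇔ (no ¬P)  {true}  P⇔b = ⊥-elim (¬P (Equivalence.from P⇔b refl))
does-⇔ (no ¬P)  {false} P⇔b = refl

map-allFin-suc : ∀ (f : Fin (suc n) → X) → map f (allFin (suc n)) ≡ f zero ∷ map (f ∘ suc) (allFin n)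
map-allFin-suc f = cong (f zero ∷_) (trans (LP.map-tabulate suc f) (sym (LP.map-tabulate id (f ∘ suc))))

count-allFin-suc : ∀ (P : Fin (suc n) → Bool) →
                   count P (allFin (suc n)) ≡ indicator (P zero) + count (P ∘ suc) (allFin n)
count-allFin-suc {n} P =
  cong (indicator (P zero) +_)
       (trans (cong (count P) (sym (LP.map-tabulate id suc))) (count-map P suc (allFin n)))

toList-tabulate : ∀ (f : Fin n → X) → Vec.toList (Vec.tabulate f) ≡ tabulate f
toList-tabulate {zero}  f = refl
toList-tabulate {suc n} f = cong (f zero ∷_) (toList-tabulate (f ∘ suc))

drop-tabulate : ∀ (f : Fin n → X) i → drop (toℕ i) (tabulate f) ≡ f i ∷ drop (suc (toℕ i)) (tabulate f)
drop-tabulate f zero    = refl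
drop-tabulate f (suc i) = drop-tabulate (f ∘ suc) i

takeWhile-accept : ∀ {P : Pred X p} (P? : Decidable P) {x xs} → P x →
                   takeWhile P? (x ∷ xs) ≡ x ∷ takeWhile P? xs
takeWhile-accept P? {x} Px with P? x
... | yes _  = refl
... | no ¬Px = ⊥-elim (¬Px Px)

takeWhile-reject : ∀ {P : Pred X p} (P? : Decidable P) {x xs} → ¬ P x → takeWhile P? (x ∷ xs) ≡ []
takeWhile-reject P? {x} ¬Px with P? x
... | yes Px = ⊥-elim (¬Px Px)
... | no _   = refl

concatMap-∷ʳ : ∀ (f : X → List Y) xs x → concatMap f (xs ++ x ∷ []) ≡ concatMap f xs ++ f x
concatMap-∷ʳ f xs x =
  trans (LP.concatMap-++ f xs (x ∷ [])) (cong (concatMap f xs ++_) (LP.++-identityʳ (f x)))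

replicate-+ : ∀ i j (x : X) → replicate i x ++ replicate j x ≡ replicate (i + j) x
replicate-+ zero    j x = refl
replicate-+ (suc i) j x = cong (x ∷_) (replicate-+ i j x)

Unique-middle : ∀ (xs : List X) {x ys} → Unique (xs ++ x ∷ ys) → All (x ≢_) xs × All (x ≢_) ys
Unique-middle []       (x∉ys ∷ _) = [] , x∉ys
Unique-middle (z ∷ xs) (z∉ ∷ u) with l , r ← Unique-middle xs u =
  ≢-sym (All.head (AllP.++⁻ʳ xs z∉)) ∷ l , r

map-≡-just : ∀ {f : X → Y} mx {y} → Maybe.map f mx ≡ just y → ∃ λ x → mx ≡ just x × f x ≡ y
map-≡-just (just x) refl = x , refl , refl

module ΣNat = CommutativeMonoidSum +-0-commutativeMonoid
module ΠNat = CommutativeMonoidSum *-1-commutativeMonoid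

sum-map-allFin : ∀ (f : Fin n → ℕ) → sum (map f (allFin n)) ≡ ΣNat.sum f
sum-map-allFin {zero}  f = refl
sum-map-allFin {suc n} f =
  trans (cong sum (map-allFin-suc f)) (cong (f zero +_) (sum-map-allFin (f ∘ suc)))

product-map-allFin : ∀ (f : Fin n → ℕ) → product (map f (allFin n)) ≡ ΠNat.sum f
product-map-allFin {zero}  f = refl
product-map-allFin {suc n} f =
  trans (cong product (map-allFin-suc f)) (cong (f zero *_) (product-map-allFin (f ∘ suc)))

sum-permute : ∀ (f : Fin n → ℕ) (π : Permutation′ n) →
              sum (map (f ∘ (π ⟨$⟩ʳ_)) (allFin n)) ≡ sum (map f (allFin n))
sum-permute f π = begin
  sum (map (f ∘ (π ⟨$⟩ʳ_)) (allFin _)) ≡⟨ sum-map-allFin (f ∘ (π ⟨$⟩ʳ_)) ⟩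
  ΣNat.sum (f ∘ (π ⟨$⟩ʳ_))             ≡⟨ ΣNat.∑-permute f π ⟨
  ΣNat.sum f                           ≡⟨ sum-map-allFin f ⟨
  sum (map f (allFin _))               ∎
  where open ≡-Reasoning

product-permute : ∀ (f : Fin n → ℕ) (π : Permutation′ n) →
                  product (map (f ∘ (π ⟨$⟩ʳ_)) (allFin n)) ≡ product (map f (allFin n))
product-permute f π = begin
  product (map (f ∘ (π ⟨$⟩ʳ_)) (allFin _)) ≡⟨ product-map-allFin (f ∘ (π ⟨$⟩ʳ_)) ⟩
  ΠNat.sum (f ∘ (π ⟨$⟩ʳ_))                 ≡⟨ ΠNat.∑-permute f π ⟨
  ΠNat.sum f                               ≡⟨ product-map-allFin f ⟨
  product (map f (allFin _))               ∎
  where open ≡-Reasoning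

-- Counting vectors coordinatewise

allCoordinates : (Fin k → Fin m → Bool) → Vec (Fin m) k → Bool
allCoordinates Q []ᵥ       = true
allCoordinates Q (a ∷ᵥ v) = Q zero a ∧ allCoordinates (Q ∘ suc) v

allCoordinates-sound : ∀ (Q : Fin k → Fin m → Bool) v →
                       allCoordinates Q v ≡ true → ∀ c → Q c (lookup v c) ≡ true
allCoordinates-sound Q (a ∷ᵥ v) h c with Q zero a in Qa
allCoordinates-sound Q (a ∷ᵥ v) h zero    | true = Qa
allCoordinates-sound Q (a ∷ᵥ v) h (suc c) | true = allCoordinates-sound (Q ∘ suc) v h c

allCoordinates-complete : ∀ (Q : Fin k → Fin m → Bool) v →
                          (∀ c → Q c (lookup v c) ≡ true) → allCoordinates Q v ≡ true
allCoordinates-complete Q []ᵥ       h = refl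
allCoordinates-complete Q (a ∷ᵥ v) h rewrite h zero = allCoordinates-complete (Q ∘ suc) v (h ∘ suc)

count-allCoordinates-∷ : ∀ (Q : Fin (suc k) → Fin m → Bool) vs as →
  count (allCoordinates Q) (concatMap (λ a → map (a ∷ᵥ_) vs) as) ≡
  count (Q zero) as * count (allCoordinates (Q ∘ suc)) vs
count-allCoordinates-∷ Q vs []       = refl
count-allCoordinates-∷ {k = k} {m = m} Q vs (a ∷ as) = begin
  count Q* (map (a ∷ᵥ_) vs ++ concatMap (λ a → map (a ∷ᵥ_) vs) as)
    ≡⟨ count-++ Q* (map (a ∷ᵥ_) vs) _ ⟩
  count Q* (map (a ∷ᵥ_) vs) + count Q* (concatMap (λ a → map (a ∷ᵥ_) vs) as)
    ≡⟨ cong₂ _+_ (trans (count-map Q* (a ∷ᵥ_) vs) (count-∧ˡ (Q zero a) _ vs))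
                 (count-allCoordinates-∷ Q vs as) ⟩
  indicator (Q zero a) * rest + count (Q zero) as * rest
    ≡⟨ *-distribʳ-+ rest (indicator (Q zero a)) _ ⟨
  count (Q zero) (a ∷ as) * rest ∎
  where
  open ≡-Reasoning
  Q* : Vec (Fin m) (suc k) → Bool
  Q* = allCoordinates Q
  rest : ℕ
  rest = count (allCoordinates (Q ∘ suc)) vs

count-allCoordinates : ∀ (Q : Fin k → Fin m → Bool) →
  count (allCoordinates Q) (allVecs m k) ≡ product (map (λ c → count (Q c) (allFin m)) (allFin k))
count-allCoordinates {zero}      Q = refl
count-allCoordinates {suc k} {m} Q = begin
  count (allCoordinates Q) (allVecs m (suc k))
    ≡⟨ count-allCoordinates-∷ Q (allVecs m k) (allFin m) ⟩
  count (Q zero) (allFin m) * count (allCoordinates (Q ∘ suc)) (allVecs m k)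
    ≡⟨ cong (count (Q zero) (allFin m) *_) (count-allCoordinates (Q ∘ suc)) ⟩
  count (Q zero) (allFin m) * product (map (λ c → count (Q (suc c)) (allFin m)) (allFin k))
    ≡⟨ cong product (map-allFin-suc (λ c → count (Q c) (allFin m))) ⟨
  product (map (λ c → count (Q c) (allFin m)) (allFin (suc k))) ∎
  where open ≡-Reasoning

gap : ℕ → Street n
gap ℓ = replicate ℓ nothing

block : ℕ → Fin n → Street n
block ℓ c = replicate ℓ (just c)

fill-gap : ∀ ℓ (c : Fin n) t → fill ℓ c (gap ℓ ++ t) ≡ just (block ℓ c ++ t)
fill-gap zero    c t = refl
fill-gap (suc ℓ) c t rewrite fill-gap ℓ c t = refl

_≟ᵒ_ : DecidableEquality (Maybe (Fin n))
_≟ᵒ_ = MaybeP.≡-dec FinP._≟_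

occ : Maybe (Fin n) → Street n → ℕ
occ e = count (λ o → does (e ≟ᵒ o))

occ-++ : ∀ (e : Maybe (Fin n)) s t → occ e (s ++ t) ≡ occ e s + occ e t
occ-++ e = count-++ _

occ-∷-self : ∀ (e : Maybe (Fin n)) s → occ e (e ∷ s) ≡ suc (occ e s)
occ-∷-self e s rewrite dec-true (e ≟ᵒ e) refl = refl

occ-∷-≢ : ∀ {e o : Maybe (Fin n)} s → e ≢ o → occ e (o ∷ s) ≡ occ e s
occ-∷-≢ {e = e} {o} s e≢o rewrite dec-false (e ≟ᵒ o) e≢o = refl

occ-∷-self-≢0 : ∀ (e : Maybe (Fin n)) s → occ e (e ∷ s) ≢ 0
occ-∷-self-≢0 e s h = 0≢1+n (trans (sym h) (occ-∷-self e s))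

occ-replicate-self : ∀ (e : Maybe (Fin n)) ℓ → occ e (replicate ℓ e) ≡ ℓ
occ-replicate-self e zero    = refl
occ-replicate-self e (suc ℓ) = trans (occ-∷-self e (replicate ℓ e)) (cong suc (occ-replicate-self e ℓ))

occ-replicate-≢ : ∀ {e o : Maybe (Fin n)} ℓ → e ≢ o → occ e (replicate ℓ o) ≡ 0
occ-replicate-≢ zero    e≢o = refl
occ-replicate-≢ {o = o} (suc ℓ) e≢o = trans (occ-∷-≢ (replicate ℓ o) e≢o) (occ-replicate-≢ ℓ e≢o)

-- s ⊑ t: t is obtained from s by parking cars on some empty spots.
infix 4 _⊑_
data _⊑_ {n : ℕ} : Street n → Street n → Set where
  []     : [] ⊑ []
  free∷  : ∀ {o s t} → s ⊑ t → nothing ∷ s ⊑ o ∷ t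
  taken∷ : ∀ {c s t} → s ⊑ t → just c ∷ s ⊑ just c ∷ t

⊑-refl : ∀ (s : Street n) → s ⊑ s
⊑-refl []            = []
⊑-refl (nothing ∷ s) = free∷ (⊑-refl s)
⊑-refl (just c ∷ s)  = taken∷ (⊑-refl s)

⊑-trans : ∀ {s t u : Street n} → s ⊑ t → t ⊑ u → s ⊑ u
⊑-trans []         []         = []
⊑-trans (free∷ p)  (free∷ q)  = free∷ (⊑-trans p q)
⊑-trans (free∷ p)  (taken∷ q) = free∷ (⊑-trans p q)
⊑-trans (taken∷ p) (taken∷ q) = taken∷ (⊑-trans p q)

⊑-∷ : ∀ (o : Maybe (Fin n)) {s t} → s ⊑ t → o ∷ s ⊑ o ∷ t
⊑-∷ nothing  = free∷
⊑-∷ (just c) = taken∷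

⊑-tail : ∀ {o o' : Maybe (Fin n)} {s t} → o ∷ s ⊑ o' ∷ t → s ⊑ t
⊑-tail (free∷ p)  = p
⊑-tail (taken∷ p) = p

⊑-head-just : ∀ {c : Fin n} {o s t} → just c ∷ s ⊑ o ∷ t → o ≡ just c
⊑-head-just (taken∷ _) = refl

⊑-occ : ∀ (c : Fin n) {s t} → s ⊑ t → occ (just c) s ≤ occ (just c) t
⊑-occ c []                  = z≤n
⊑-occ c (free∷ p)           = ≤-trans (⊑-occ c p) (m≤n+m _ _)
⊑-occ c {just d ∷ _} (taken∷ p) = +-monoʳ-≤ (indicator (does (just c ≟ᵒ just d))) (⊑-occ c p)

fill-⊑ : ∀ ℓ (c : Fin n) s {s'} → fill ℓ c s ≡ just s' → s ⊑ s'
fill-⊑ zero    c s             refl = ⊑-refl s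
fill-⊑ (suc ℓ) c (nothing ∷ s) h with s₁ , h₁ , refl ← map-≡-just (fill ℓ c s) h = free∷ (fill-⊑ ℓ c s h₁)

parkCar-⊑ : ∀ p ℓ (c : Fin n) s {s'} → parkCar p ℓ c s ≡ just s' → s ⊑ s'
parkCar-⊑ (suc p) ℓ c (o ∷ s) h with s₁ , h₁ , refl ← map-≡-just (parkCar p ℓ c s) h =
  ⊑-∷ o (parkCar-⊑ p ℓ c s h₁)
parkCar-⊑ zero ℓ c (just d ∷ s) h with s₁ , h₁ , refl ← map-≡-just (parkCar zero ℓ c s) h =
  taken∷ (parkCar-⊑ zero ℓ c s h₁)
parkCar-⊑ zero ℓ c (nothing ∷ s) h = fill-⊑ ℓ c (nothing ∷ s) h

fill-head : ∀ ℓ (c : Fin n) s {s'} → fill (suc ℓ) c s ≡ just s' → ∃ λ t → s' ≡ just c ∷ t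
fill-head ℓ c (nothing ∷ s) h with s₁ , _ , refl ← map-≡-just (fill ℓ c s) h = s₁ , refl

+-prepend : ∀ i {x y u v} → x + u ≡ y + v → i + x + u ≡ i + y + v
+-prepend i {x} {y} {u} {v} eq = trans (+-assoc i x u) (trans (cong (i +_) eq) (sym (+-assoc i y v)))

+-interchange : ∀ i j {x y u v} → x + u ≡ y + v → i + x + (j + u) ≡ j + y + (i + v)
+-interchange i j {x} {y} {u} {v} eq = begin
  i + x + (j + u) ≡⟨ lhs i j x u ⟩
  x + u + (i + j) ≡⟨ cong (_+ (i + j)) eq ⟩
  y + v + (i + j) ≡⟨ rhs i j y v ⟩
  j + y + (i + v) ∎
  where
  open ≡-Reasoning
  lhs : ∀ i j x u → i + x + (j + u) ≡ x + u + (i + j)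
  lhs = solve-∀
  rhs : ∀ i j y v → y + v + (i + j) ≡ j + y + (i + v)
  rhs = solve-∀

-- Stated additively to avoid truncated subtraction.
fill-occ : ∀ ℓ (c : Fin n) s {s'} e → fill ℓ c s ≡ just s' →
           occ e s' + occ e (gap ℓ) ≡ occ e s + occ e (block ℓ c)
fill-occ zero    c s             e refl = refl
fill-occ (suc ℓ) c (nothing ∷ s) e h with s₁ , h₁ , refl ← map-≡-just (fill ℓ c s) h =
  +-interchange (indicator (does (e ≟ᵒ just c))) (indicator (does (e ≟ᵒ nothing))) (fill-occ ℓ c s e h₁)

parkCar-occ : ∀ p ℓ (c : Fin n) s {s'} e → parkCar p ℓ c s ≡ just s' →
              occ e s' + occ e (gap ℓ) ≡ occ e s + occ e (block ℓ c)
parkCar-occ (suc p) ℓ c (o ∷ s) e h with s₁ , h₁ , refl ← map-≡-just (parkCar p ℓ c s) h =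
  +-prepend (indicator (does (e ≟ᵒ o))) (parkCar-occ p ℓ c s e h₁)
parkCar-occ zero ℓ c (just d ∷ s) e h with s₁ , h₁ , refl ← map-≡-just (parkCar zero ℓ c s) h =
  +-prepend (indicator (does (e ≟ᵒ just d))) (parkCar-occ zero ℓ c s e h₁)
parkCar-occ zero ℓ c (nothing ∷ s) e h = fill-occ ℓ c (nothing ∷ s) e h

occ-parkCar-self : ∀ p ℓ (c : Fin n) s {s'} → parkCar p ℓ c s ≡ just s' →
                   occ (just c) s ≡ 0 → occ (just c) s' ≡ ℓ
occ-parkCar-self p ℓ c s {s'} h s∌c = begin
  occ (just c) s'
    ≡⟨ +-identityʳ _ ⟨
  occ (just c) s' + 0
    ≡⟨ cong (occ (just c) s' +_) (occ-replicate-≢ {e = just c} ℓ λ ()) ⟨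
  occ (just c) s' + occ (just c) (gap ℓ)
    ≡⟨ parkCar-occ p ℓ c s (just c) h ⟩
  occ (just c) s + occ (just c) (block ℓ c)
    ≡⟨ cong₂ _+_ s∌c (occ-replicate-self (just c) ℓ) ⟩
  ℓ ∎
  where open ≡-Reasoning

-- Parking into a gap

-- fullFrom p A: spot p lies in A or just after it, and every spot of A from p on is occupied.
fullFrom : ℕ → Street n → Bool
fullFrom zero    []            = true
fullFrom zero    (just _ ∷ A)  = fullFrom zero A
fullFrom zero    (nothing ∷ A) = false
fullFrom (suc p) []            = false
fullFrom (suc p) (_ ∷ A)       = fullFrom p A

fullStarts : Street n → ℕ
fullStarts []      = 1
fullStarts (o ∷ A) = indicator (fullFrom 0 (o ∷ A)) + fullStarts A

count-fullFrom : ∀ m (A : Street n) → length A < m →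
                 count (λ (p : Fin m) → fullFrom (toℕ p) A) (allFin m) ≡ fullStarts A
count-fullFrom (suc m) [] _ =
  trans (count-allFin-suc (λ (p : Fin (suc m)) → fullFrom (toℕ p) []))
        (cong suc (count-false (λ _ → refl) (allFin m)))
count-fullFrom (suc m) (o ∷ A) (s≤s |A|<m) =
  trans (count-allFin-suc (λ (p : Fin (suc m)) → fullFrom (toℕ p) (o ∷ A)))
        (cong (indicator (fullFrom 0 (o ∷ A)) +_) (count-fullFrom m A |A|<m))

fullFrom-++ : ∀ (A B : Street n) → fullFrom 0 (A ++ B) ≡ fullFrom 0 A ∧ fullFrom 0 B
fullFrom-++ []            B = refl
fullFrom-++ (just _ ∷ A)  B = fullFrom-++ A B
fullFrom-++ (nothing ∷ A) B = refl

fullFrom-block : ∀ ℓ (c : Fin n) → fullFrom 0 (block ℓ c) ≡ true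
fullFrom-block zero    c = refl
fullFrom-block (suc ℓ) c = fullFrom-block ℓ c

fullStarts-full : ∀ (B : Street n) → fullFrom 0 B ≡ true → fullStarts B ≡ suc (length B)
fullStarts-full []           _ = refl
fullStarts-full (just _ ∷ B) h rewrite h = cong suc (fullStarts-full B h)

fullStarts-++-full : ∀ (A B : Street n) → fullFrom 0 B ≡ true →
                     fullStarts (A ++ B) ≡ length B + fullStarts A
fullStarts-++-full []      B h = trans (fullStarts-full B h) (sym (+-comm (length B) 1))
fullStarts-++-full (o ∷ A) B h = begin
  indicator (fullFrom 0 (o ∷ A ++ B)) + fullStarts (A ++ B)
    ≡⟨ cong₂ (λ b x → indicator b + x)
             (trans (fullFrom-++ (o ∷ A) B) (trans (cong (fullFrom 0 (o ∷ A) ∧_) h) (∧-identityʳ _)))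
             (fullStarts-++-full A B h) ⟩
  indicator (fullFrom 0 (o ∷ A)) + (length B + fullStarts A)
    ≡⟨ left-comm (indicator (fullFrom 0 (o ∷ A))) (length B) (fullStarts A) ⟩
  length B + (indicator (fullFrom 0 (o ∷ A)) + fullStarts A) ∎
  where
  open ≡-Reasoning
  left-comm : ∀ i j k → i + (j + k) ≡ j + (i + k)
  left-comm = solve-∀

fullStarts-++-blocked : ∀ (A B : Street n) → fullFrom 0 B ≡ false → fullStarts (A ++ B) ≡ fullStarts B
fullStarts-++-blocked []      B h = refl
fullStarts-++-blocked (o ∷ A) B h =
  cong₂ (λ b x → indicator b + x)
        (trans (fullFrom-++ (o ∷ A) B) (trans (cong (fullFrom 0 (o ∷ A) ∧_) h) (∧-zeroʳ _)))
        (fullStarts-++-blocked A B h)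

fullFrom-gap : ∀ {ℓ} → 1 ≤ ℓ → fullFrom 0 (gap {n} ℓ) ≡ false
fullFrom-gap (s≤s z≤n) = refl

fullStarts-gap : ∀ ℓ → fullStarts (gap {n} ℓ) ≡ 1
fullStarts-gap zero    = refl
fullStarts-gap (suc ℓ) = fullStarts-gap ℓ

parkCar-fullFrom : ∀ p {ℓ} → 1 ≤ ℓ → ∀ (c : Fin n) A B → fullFrom p A ≡ true →
                   parkCar p ℓ c (A ++ gap ℓ ++ B) ≡ just (A ++ block ℓ c ++ B)
parkCar-fullFrom zero    (s≤s z≤n) c []           B _ = fill-gap _ c B
parkCar-fullFrom zero    ℓ≥1       c (just d ∷ A) B h rewrite parkCar-fullFrom zero ℓ≥1 c A B h = refl
parkCar-fullFrom (suc p) ℓ≥1       c (o ∷ A)      B h rewrite parkCar-fullFrom p ℓ≥1 c A B h = refl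

occ-gap-++ : ∀ ℓ (c : Fin n) t → occ (just c) t ≡ 0 → occ (just c) (gap ℓ ++ t) ≡ 0
occ-gap-++ ℓ c t t∌c =
  trans (occ-++ (just c) (gap ℓ) t) (cong₂ _+_ (occ-replicate-≢ {e = just c} ℓ λ ()) t∌c)

occ-block-++ : ∀ ℓ (c : Fin n) t → occ (just c) t ≡ 0 → occ (just c) (block ℓ c ++ t) ≡ ℓ
occ-block-++ ℓ c t t∌c =
  trans (occ-++ (just c) (block ℓ c) t)
        (trans (cong₂ _+_ (occ-replicate-self (just c) ℓ) t∌c) (+-identityʳ ℓ))

-- If c parks somewhere compatible with its block filling the gap, it was led into the gap.
parks-in-gap⇒fullFrom :
  ∀ p {ℓ} → 1 ≤ ℓ → ∀ (c : Fin n) A B A' B' {s'} →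
  parkCar p ℓ c (A ++ gap ℓ ++ B) ≡ just s' → s' ⊑ A' ++ block ℓ c ++ B' → length A ≡ length A' →
  occ (just c) A' ≡ 0 → occ (just c) B ≡ 0 → occ (just c) B' ≡ 0 → fullFrom p A ≡ true
parks-in-gap⇒fullFrom zero _ c [] _ _ _ _ _ _ _ _ _ = refl
parks-in-gap⇒fullFrom zero ℓ≥1 c (just d ∷ A) B (o' ∷ A') B' h ext |A|≡|A'| A'∌c B∌c B'∌c
  with s₁ , h₁ , refl ← map-≡-just (parkCar zero _ c (A ++ gap _ ++ B)) h =
  parks-in-gap⇒fullFrom zero ℓ≥1 c A B A' B' h₁ (⊑-tail ext) (suc-injective |A|≡|A'|)
                        (m+n≡0⇒n≡0 _ A'∌c) B∌c B'∌c
parks-in-gap⇒fullFrom zero (s≤s {n = ℓ} z≤n) c (nothing ∷ A) B (o' ∷ A') B' h ext _ A'∌c _ _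
  with t , refl ← fill-head ℓ c (nothing ∷ A ++ gap (suc ℓ) ++ B) h
  with refl ← ⊑-head-just ext = ⊥-elim (occ-∷-self-≢0 (just c) A' A'∌c)
parks-in-gap⇒fullFrom (suc p) (s≤s {n = ℓ} z≤n) c [] B [] B' h ext _ _ B∌c B'∌c
  with s₁ , h₁ , refl ← map-≡-just (parkCar p (suc ℓ) c (gap ℓ ++ B)) h =
  ⊥-elim (<-irrefl refl (subst₂ _≤_ (occ-parkCar-self p (suc ℓ) c (gap ℓ ++ B) h₁ (occ-gap-++ ℓ c B B∌c))
                                     (occ-block-++ ℓ c B' B'∌c)
                                     (⊑-occ c (⊑-tail ext))))
parks-in-gap⇒fullFrom (suc p) ℓ≥1 c (o ∷ A) B (o' ∷ A') B' h ext |A|≡|A'| A'∌c B∌c B'∌c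
  with s₁ , h₁ , refl ← map-≡-just (parkCar p _ c (A ++ gap _ ++ B)) h =
  parks-in-gap⇒fullFrom p ℓ≥1 c A B A' B' h₁ (⊑-tail ext) (suc-injective |A|≡|A'|)
                        (m+n≡0⇒n≡0 _ A'∌c) B∌c B'∌c

-- Reading off the outcome

compress-block : ∀ ℓ (c : Fin n) s → compress (just c) (block ℓ c ++ s) ≡ compress (just c) s
compress-block zero    c s = refl
compress-block (suc ℓ) c s with c FinP.≟ c
... | yes _  = compress-block ℓ c s
... | no c≢c = ⊥-elim (c≢c refl)

compress-∷-new : ∀ {prev} {c : Fin n} s → prev ≢ just c →
                 compress prev (just c ∷ s) ≡ c ∷ compress (just c) s
compress-∷-new {prev = nothing}     s _    = refl
compress-∷-new {prev = just d} {c} s d≢c with d FinP.≟ c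
... | yes refl = ⊥-elim (d≢c refl)
... | no _     = refl

compress-block-new : ∀ {ℓ prev} {c : Fin n} → 1 ≤ ℓ → prev ≢ just c → ∀ s →
                     compress prev (block ℓ c ++ s) ≡ c ∷ compress (just c) s
compress-block-new {ℓ = suc ℓ} {c = c} _ prev≢c s =
  trans (compress-∷-new (block ℓ c ++ s) prev≢c) (cong (c ∷_) (compress-block ℓ c s))

∈-compress : ∀ (c : Fin n) prev s → occ (just c) s ≢ 0 → (prev ≡ just c → head s ≢ just (just c)) →
             c ∈ compress prev s
∈-compress c prev []            s∋c _ = ⊥-elim (s∋c refl)
∈-compress c prev (nothing ∷ s) s∋c _ = ∈-compress c nothing s s∋c λ ()
∈-compress c prev (just e ∷ s)  s∋c new with e FinP.≟ c
∈-compress c nothing  (just .c ∷ s) s∋c new | yes refl = here refl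
∈-compress c (just d) (just .c ∷ s) s∋c new | yes refl with d FinP.≟ c
... | yes refl = ⊥-elim (new refl refl)
... | no _     = here refl
∈-compress c prev (just e ∷ s) s∋c new | no e≢c = continue prev
  where
  c∈rest : c ∈ compress (just e) s
  c∈rest = ∈-compress c (just e) s (s∋c ∘ trans (occ-∷-≢ s (e≢c ∘ sym ∘ just-injective)))
                      (λ e≡c → ⊥-elim (e≢c (just-injective e≡c)))
  continue : ∀ prev → c ∈ compress prev (just e ∷ s)
  continue nothing  = there c∈rest
  continue (just d) with d FinP.≟ e
  ... | yes _ = c∈rest
  ... | no _  = there c∈rest

split-run : ∀ (c : Fin n) s → ∃₂ λ r t → s ≡ block r c ++ t × head t ≢ just (just c)
split-run c []            = 0 , [] , refl , λ ()
split-run c (nothing ∷ s) = 0 , nothing ∷ s , refl , λ ()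
split-run c (just d ∷ s) with d FinP.≟ c
... | yes refl with r , t , refl , t≢c ← split-run c s = suc r , t , refl , t≢c
... | no d≢c = 0 , just d ∷ s , refl , d≢c ∘ just-injective ∘ just-injective

blocks : (Fin n → ℕ) → List (Fin n) → Street n
blocks y = concatMap (λ c → block (y c) c)

module _ (y : Fin n → ℕ) where

  occ-blocks-∉ : ∀ {c} w → All (c ≢_) w → occ (just c) (blocks y w) ≡ 0
  occ-blocks-∉     []      _           = refl
  occ-blocks-∉ {c} (d ∷ w) (c≢d ∷ c∉w) =
    trans (occ-++ (just c) (block (y d) d) (blocks y w))
          (cong₂ _+_ (occ-replicate-≢ (y d) (c≢d ∘ just-injective)) (occ-blocks-∉ w c∉w))

  occ-blocks-nothing : ∀ w → occ nothing (blocks y w) ≡ 0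
  occ-blocks-nothing []      = refl
  occ-blocks-nothing (d ∷ w) =
    trans (occ-++ nothing (block (y d) d) (blocks y w))
          (cong₂ _+_ (occ-replicate-≢ {e = nothing} (y d) λ ()) (occ-blocks-nothing w))

  ≢-head : ∀ {prev e} w → All (λ d → prev ≢ just d) w → occ (just e) (blocks y w) ≢ 0 → prev ≢ just e
  ≢-head w prev∉ w∋e refl = w∋e (occ-blocks-∉ w (All.map (_∘ cong just) prev∉))

  length-blocks : ∀ w → length (blocks y w) ≡ sum (map y w)
  length-blocks []      = refl
  length-blocks (d ∷ w) =
    trans (LP.length-++ (block (y d) d)) (cong₂ _+_ (LP.length-replicate (y d)) (length-blocks w))

  compress-blocks : (∀ i → 1 ≤ y i) → ∀ prev w → Unique w → All (λ d → prev ≢ just d) w →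
                    compress prev (blocks y w) ≡ w
  compress-blocks y⁺ prev []      _           _              = refl
  compress-blocks y⁺ prev (c ∷ w) (c∉w ∷ u) (prev≢c ∷ _) =
    trans (compress-block-new (y⁺ c) prev≢c (blocks y w))
          (cong (c ∷_) (compress-blocks y⁺ (just c) w u (All.map (_∘ just-injective) c∉w)))

  -- Once the run of c ends, c cannot occur again, since compress would list it a second time.
  compress⁻¹-blocks : ∀ prev w F → Unique w → All (λ d → prev ≢ just d) w →
                      (∀ e → occ e F ≡ occ e (blocks y w)) → compress prev F ≡ w → F ≡ blocks y w
  compress⁻¹-blocks prev []      []            _ _ _  _ = refl
  compress⁻¹-blocks prev []      (o ∷ F)       _ _ F≈ _ = ⊥-elim (occ-∷-self-≢0 o F (F≈ o))
  compress⁻¹-blocks prev (c ∷ w) []            _ _ _  ()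
  compress⁻¹-blocks prev (c ∷ w) (nothing ∷ F) _ _ F≈ _ =
    ⊥-elim (occ-∷-self-≢0 nothing F (trans (F≈ nothing) (occ-blocks-nothing (c ∷ w))))
  compress⁻¹-blocks prev (c ∷ w) (just e ∷ F) (c∉w ∷ u) prev∉ F≈ reads
    with refl , reads′ ← LP.∷-injective (trans (sym (compress-∷-new F
           (≢-head (c ∷ w) prev∉ (occ-∷-self-≢0 (just e) F ∘ trans (F≈ (just e)))))) reads)
    with r , F″ , refl , F″≢c ← split-run c F =
    cong₂ (λ ℓ t → block ℓ c ++ t) (sym y≡)
          (compress⁻¹-blocks (just c) w F″ u (All.map (_∘ just-injective) c∉w) F″≈ reads″)
    where
    reads″ : compress (just c) F″ ≡ w
    reads″ = trans (sym (compress-block r c F″)) reads′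
    F″∌c : occ (just c) F″ ≡ 0
    F″∌c = decidable-stable (occ (just c) F″ ℕ.≟ 0) λ F″∋c →
      AllP.All¬⇒¬Any c∉w (subst (c ∈_) reads″ (∈-compress c (just c) F″ F″∋c λ _ → F″≢c))
    y≡ : y c ≡ suc r
    y≡ = trans (sym (occ-block-++ (y c) c (blocks y w) (occ-blocks-∉ w c∉w)))
               (trans (sym (F≈ (just c))) (occ-block-++ (suc r) c F″ F″∌c))
    F″≈ : ∀ e → occ e F″ ≡ occ e (blocks y w)
    F″≈ e = +-cancelˡ-≡ (occ e (block (suc r) c)) _ _ (begin
      occ e (block (suc r) c) + occ e F″
        ≡⟨ occ-++ e (block (suc r) c) F″ ⟨
      occ e (block (suc r) c ++ F″)
        ≡⟨ F≈ e ⟩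
      occ e (block (y c) c ++ blocks y w)
        ≡⟨ occ-++ e (block (y c) c) (blocks y w) ⟩
      occ e (block (y c) c) + occ e (blocks y w)
        ≡⟨ cong (λ ℓ → occ e (block ℓ c) + occ e (blocks y w)) y≡ ⟩
      occ e (block (suc r) c) + occ e (blocks y w) ∎)
      where open ≡-Reasoning

-- The cars of a fixed outcome, parked one at a time

data CarsFrom (n : ℕ) : ℕ → List (Fin n) → Set where
  done : n ≤ k → CarsFrom n k []
  next : ∀ {c cs} → toℕ c ≡ k → CarsFrom n (suc k) cs → CarsFrom n k (c ∷ cs)

tabulate-CarsFrom : ∀ {j} k (f : Fin j → Fin n) → (∀ i → toℕ (f i) ≡ k + toℕ i) → k + j ≡ n →
                    CarsFrom n k (tabulate f)
tabulate-CarsFrom {j = zero}  k f _  k≡n   = done (≤-reflexive (trans (sym k≡n) (+-identityʳ k)))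
tabulate-CarsFrom {j = suc j} k f f≗ k+j≡n =
  next (trans (f≗ zero) (+-identityʳ k))
       (tabulate-CarsFrom (suc k) (f ∘ suc) (λ i → trans (f≗ (suc i)) (+-suc k (toℕ i)))
                          (trans (sym (+-suc k j)) k+j≡n))

allFin-CarsFrom : ∀ n → CarsFrom n 0 (allFin n)
allFin-CarsFrom n = tabulate-CarsFrom 0 id (λ _ → refl) refl

module Fibre {n} (y : Fin n → ℕ) (y⁺ : ∀ i → 1 ≤ y i) (σ : Permutation′ n) where

  order : List (Fin n)
  order = tabulate (σ ⟨$⟩ʳ_)

  word≡order : word σ ≡ order
  word≡order = toList-tabulate (σ ⟨$⟩ʳ_)

  position : Fin n → ℕ
  position c = toℕ (σ ⟨$⟩ˡ c)

  before after : Fin n → List (Fin n)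
  before c = take (position c) order
  after  c = drop (suc (position c)) order

  order-split : ∀ c → order ≡ before c ++ c ∷ after c
  order-split c = begin
    order                                   ≡⟨ LP.take++drop≡id (position c) order ⟨
    before c ++ drop (position c) order     ≡⟨ cong (before c ++_) (drop-tabulate (σ ⟨$⟩ʳ_) (σ ⟨$⟩ˡ c)) ⟩
    before c ++ (σ ⟨$⟩ʳ (σ ⟨$⟩ˡ c)) ∷ after c ≡⟨ cong (λ d → before c ++ d ∷ after c) (inverseʳ σ) ⟩
    before c ++ c ∷ after c                 ∎
    where open ≡-Reasoning

  order-unique : Unique order
  order-unique = UniqueP.tabulate⁺ (Injection.injective (Inverse⇒Injection σ))

  ∉-before-after : ∀ c → All (c ≢_) (before c) × All (c ≢_) (after c)
  ∉-before-after c = Unique-middle (before c) (subst Unique (order-split c) order-unique)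

  spots≡ : spots y ≡ sum (map y order)
  spots≡ = trans (sym (sum-permute y σ)) (cong sum (trans (LP.map-tabulate id (y ∘ (σ ⟨$⟩ʳ_)))
                                                          (sym (LP.map-tabulate (σ ⟨$⟩ʳ_) y))))

  -- slot k e: the spots of car e in the layout σ, once the cars 0, …, k − 1 have parked.
  slot : ℕ → Fin n → Street n
  slot k e = if does (toℕ e ℕ.<? k) then block (y e) e else gap (y e)

  stage : ℕ → Street n
  stage k = concatMap (slot k) order

  left right : Fin n → Street n
  left  c = concatMap (slot (toℕ c)) (before c)
  right c = concatMap (slot (toℕ c)) (after c)

  slot-parked : ∀ {k} e → toℕ e < k → slot k e ≡ block (y e) e
  slot-parked {k} e e<k = cong (λ b → if b then block (y e) e else gap (y e)) (dec-true (toℕ e ℕ.<? k) e<k)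

  slot-empty : ∀ {k} e → toℕ e ≮ k → slot k e ≡ gap (y e)
  slot-empty {k} e e≮k = cong (λ b → if b then block (y e) e else gap (y e)) (dec-false (toℕ e ℕ.<? k) e≮k)

  slot-step : ∀ {c e} → c ≢ e → slot (suc (toℕ c)) e ≡ slot (toℕ c) e
  slot-step {c} {e} c≢e with toℕ e ℕ.<? toℕ c
  ... | yes e<c = trans (slot-parked e (m<n⇒m<1+n e<c)) (sym (slot-parked e e<c))
  ... | no  e≮c = trans (slot-empty e e≮1+c) (sym (slot-empty e e≮c))
    where
    e≮1+c : toℕ e ≮ suc (toℕ c)
    e≮1+c e<1+c = e≮c (≤∧≢⇒< (≤-pred e<1+c) (c≢e ∘ sym ∘ FinP.toℕ-injective))

  slots-step : ∀ {c} v → All (c ≢_) v → concatMap (slot (suc (toℕ c))) v ≡ concatMap (slot (toℕ c)) v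
  slots-step []      []          = refl
  slots-step (e ∷ v) (c≢e ∷ c∉v) = cong₂ _++_ (slot-step c≢e) (slots-step v c∉v)

  length-slots : ∀ k v → length (concatMap (slot k) v) ≡ sum (map y v)
  length-slots k []      = refl
  length-slots k (e ∷ v) = trans (LP.length-++ (slot k e)) (cong₂ _+_ length-slot (length-slots k v))
    where
    length-slot : length (slot k e) ≡ y e
    length-slot with toℕ e ℕ.<? k
    ... | yes e<k = trans (cong length (slot-parked e e<k)) (LP.length-replicate (y e))
    ... | no  e≮k = trans (cong length (slot-empty e e≮k)) (LP.length-replicate (y e))

  occ-slots-∉ : ∀ {c} k v → All (c ≢_) v → occ (just c) (concatMap (slot k) v) ≡ 0
  occ-slots-∉         k []      []          = refl
  occ-slots-∉ {c = c} k (e ∷ v) (c≢e ∷ c∉v) =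
    trans (occ-++ (just c) (slot k e) _) (cong₂ _+_ occ-slot (occ-slots-∉ k v c∉v))
    where
    occ-slot : occ (just c) (slot k e) ≡ 0
    occ-slot with toℕ e ℕ.<? k
    ... | yes e<k = trans (cong (occ (just c)) (slot-parked e e<k))
                          (occ-replicate-≢ (y e) (c≢e ∘ just-injective))
    ... | no  e≮k = trans (cong (occ (just c)) (slot-empty e e≮k))
                          (occ-replicate-≢ {e = just c} (y e) λ ())

  stage-at : ∀ c → stage (toℕ c) ≡ left c ++ gap (y c) ++ right c
  stage-at c = begin
    stage (toℕ c)
      ≡⟨ cong (concatMap (slot (toℕ c))) (order-split c) ⟩
    concatMap (slot (toℕ c)) (before c ++ c ∷ after c)
      ≡⟨ LP.concatMap-++ (slot (toℕ c)) (before c) (c ∷ after c) ⟩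
    left c ++ slot (toℕ c) c ++ right c
      ≡⟨ cong (λ t → left c ++ t ++ right c) (slot-empty c (<-irrefl refl)) ⟩
    left c ++ gap (y c) ++ right c ∎
    where open ≡-Reasoning

  stage-suc : ∀ c → stage (suc (toℕ c)) ≡ left c ++ block (y c) c ++ right c
  stage-suc c = begin
    stage (suc (toℕ c))
      ≡⟨ cong (concatMap (slot (suc (toℕ c)))) (order-split c) ⟩
    concatMap (slot (suc (toℕ c))) (before c ++ c ∷ after c)
      ≡⟨ LP.concatMap-++ (slot (suc (toℕ c))) (before c) (c ∷ after c) ⟩
    concatMap (slot (suc (toℕ c))) (before c) ++ slot (suc (toℕ c)) c ++
      concatMap (slot (suc (toℕ c))) (after c)
      ≡⟨ cong₂ _++_ (slots-step (before c) (proj₁ (∉-before-after c)))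
                    (cong₂ _++_ (slot-parked c ≤-refl) (slots-step (after c) (proj₂ (∉-before-after c)))) ⟩
    left c ++ block (y c) c ++ right c
      ∎
    where open ≡-Reasoning

  blocks-split : ∀ c → blocks y order ≡ blocks y (before c) ++ block (y c) c ++ blocks y (after c)
  blocks-split c = trans (cong (blocks y) (order-split c)) (LP.concatMap-++ _ (before c) (c ∷ after c))

  stage-complete : ∀ {k} → n ≤ k → stage k ≡ blocks y order
  stage-complete n≤k = LP.concatMap-cong (λ e → slot-parked e (<-≤-trans (FinP.toℕ<n e) n≤k)) order

  stage-empty : gap (spots y) ≡ stage 0
  stage-empty = trans (cong gap spots≡) (sym (slots-empty order))
    where
    slots-empty : ∀ v → concatMap (slot 0) v ≡ gap (sum (map y v))
    slots-empty []      = refl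
    slots-empty (e ∷ v) =
      trans (cong₂ _++_ (slot-empty {k = 0} e λ ()) (slots-empty v)) (replicate-+ (y e) (sum (map y v)) nothing)

  length-left : ∀ c → length (left c) < spots y
  length-left c = begin-strict
    length (left c)
      <⟨ m<m+n _ (≤-trans (y⁺ c) (m≤m+n (y c) _)) ⟩
    length (left c) + (y c + length (right c))
      ≡⟨ cong (λ ℓ → length (left c) + (ℓ + length (right c)))
                                                                     (LP.length-replicate (y c)) ⟨
    length (left c) + (length (gap (y c)) + length (right c))
      ≡⟨ cong (length (left c) +_) (LP.length-++ (gap (y c))) ⟨
    length (left c) + length (gap (y c) ++ right c)
      ≡⟨ LP.length-++ (left c) ⟨
    length (left c ++ gap (y c) ++ right c)
      ≡⟨ cong length (stage-at c) ⟨
    length (stage (toℕ c))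
      ≡⟨ length-slots (toℕ c) order ⟩
    sum (map y order)
      ≡⟨ spots≡ ⟨
    spots y ∎
    where open ≤-Reasoning

  slots-reverse-∷ : ∀ k e u → concatMap (slot k) (reverse (e ∷ u)) ≡ concatMap (slot k) (reverse u) ++ slot k e
  slots-reverse-∷ k e u =
    trans (cong (concatMap (slot k)) (LP.unfold-reverse e u)) (concatMap-∷ʳ (slot k) (reverse u) e)

  -- The occupied spots directly in front of c's slot are the blocks of the cars in L(y, c).
  fullStarts-slots : ∀ (c : Fin n) u →
                     fullStarts (concatMap (slot (toℕ c)) (reverse u)) ≡ suc (sum (map y (takeWhile (_<? c) u)))
  fullStarts-slots c []      = refl
  fullStarts-slots c (e ∷ u) with toℕ e ℕ.<? toℕ c
  ... | yes e<c = begin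
    fullStarts (concatMap (slot (toℕ c)) (reverse (e ∷ u)))
      ≡⟨ cong fullStarts (slots-reverse-∷ (toℕ c) e u) ⟩
    fullStarts (S ++ slot (toℕ c) e)
      ≡⟨ cong (λ t → fullStarts (S ++ t)) (slot-parked e e<c) ⟩
    fullStarts (S ++ block (y e) e)
      ≡⟨ fullStarts-++-full S _ (fullFrom-block (y e) e) ⟩
    length (block (y e) e) + fullStarts S
      ≡⟨ cong₂ _+_ (LP.length-replicate (y e)) (fullStarts-slots c u) ⟩
    y e + suc (sum (map y (takeWhile (_<? c) u)))
      ≡⟨ +-suc (y e) _ ⟩
    suc (sum (map y (e ∷ takeWhile (_<? c) u)))
      ≡⟨ cong (suc ∘ sum ∘ map y) (takeWhile-accept (_<? c) e<c) ⟨
    suc (sum (map y (takeWhile (_<? c) (e ∷ u)))) ∎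
    where
    open ≡-Reasoning
    S : Street n
    S = concatMap (slot (toℕ c)) (reverse u)
  ... | no e≮c = begin
    fullStarts (concatMap (slot (toℕ c)) (reverse (e ∷ u)))
      ≡⟨ cong fullStarts (slots-reverse-∷ (toℕ c) e u) ⟩
    fullStarts (S ++ slot (toℕ c) e)
      ≡⟨ cong (λ t → fullStarts (S ++ t)) (slot-empty e e≮c) ⟩
    fullStarts (S ++ gap (y e))
      ≡⟨ fullStarts-++-blocked S _ (fullFrom-gap (y⁺ e)) ⟩
    fullStarts (gap {n} (y e))
      ≡⟨ fullStarts-gap (y e) ⟩
    1
      ≡⟨ cong (suc ∘ sum ∘ map y) (takeWhile-reject (_<? c) e≮c) ⟨
    suc (sum (map y (takeWhile (_<? c) (e ∷ u)))) ∎
    where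
    open ≡-Reasoning
    S : Street n
    S = concatMap (slot (toℕ c)) (reverse u)

  factor : Fin n → ℕ
  factor i = 1 + sum (map y (L σ i))

  fullStarts-left : ∀ c → fullStarts (left c) ≡ factor (σ ⟨$⟩ˡ c)
  fullStarts-left c = begin
    fullStarts (left c)
      ≡⟨ cong (fullStarts ∘ concatMap (slot (toℕ c))) (LP.reverse-involutive (before c)) ⟨
    fullStarts (concatMap (slot (toℕ c)) (reverse (reverse (before c))))
      ≡⟨ fullStarts-slots c (reverse (before c)) ⟩
    suc (sum (map y (takeWhile (_<? c) (reverse (before c)))))
      ≡⟨ cong₂ (λ d ws → suc (sum (map y (takeWhile (_<? d) (reverse (take (position c) ws))))))
               (inverseʳ σ) word≡order ⟨
    factor (σ ⟨$⟩ˡ c)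
      ∎
    where open ≡-Reasoning

  occ-stage-suc : ∀ c e → occ e (stage (toℕ c)) + occ e (block (y c) c) ≡
                          occ e (stage (suc (toℕ c))) + occ e (gap (y c))
  occ-stage-suc c e = begin
    occ e (stage (toℕ c)) + occ e blockᶜ
      ≡⟨ cong (λ s → occ e s + occ e blockᶜ) (stage-at c) ⟩
    occ e (left c ++ gapᶜ ++ right c) + occ e blockᶜ
      ≡⟨ cong (_+ occ e blockᶜ) (occ-around gapᶜ) ⟩
    occ e (left c) + (occ e gapᶜ + occ e (right c)) + occ e blockᶜ
      ≡⟨ exchange (occ e (left c)) (occ e gapᶜ) (occ e (right c)) (occ e blockᶜ) ⟩
    occ e (left c) + (occ e blockᶜ + occ e (right c)) + occ e gapᶜ
      ≡⟨ cong (_+ occ e gapᶜ) (occ-around blockᶜ) ⟨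
    occ e (left c ++ blockᶜ ++ right c) + occ e gapᶜ
      ≡⟨ cong (λ s → occ e s + occ e gapᶜ) (stage-suc c) ⟨
    occ e (stage (suc (toℕ c))) + occ e gapᶜ ∎
    where
    open ≡-Reasoning
    gapᶜ blockᶜ : Street n
    gapᶜ = gap (y c)
    blockᶜ = block (y c) c
    occ-around : ∀ t → occ e (left c ++ t ++ right c) ≡ occ e (left c) + (occ e t + occ e (right c))
    occ-around t =
      trans (occ-++ e (left c) (t ++ right c)) (cong (occ e (left c) +_) (occ-++ e t (right c)))
    exchange : ∀ i g r j → i + (g + r) + j ≡ i + (j + r) + g
    exchange = solve-∀

  occ-parkCar-stage : ∀ c p {s s'} → parkCar p (y c) c s ≡ just s' →
                      (∀ e → occ e s ≡ occ e (stage (toℕ c))) → ∀ e → occ e s' ≡ occ e (stage (suc (toℕ c)))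
  occ-parkCar-stage c p {s} {s'} h s≈ e = +-cancelʳ-≡ (occ e (gap (y c))) _ _ (begin
    occ e s' + occ e (gap (y c))                    ≡⟨ parkCar-occ p (y c) c s e h ⟩
    occ e s + occ e (block (y c) c)                 ≡⟨ cong (_+ occ e (block (y c) c)) (s≈ e) ⟩
    occ e (stage (toℕ c)) + occ e (block (y c) c)   ≡⟨ occ-stage-suc c e ⟩
    occ e (stage (suc (toℕ c))) + occ e (gap (y c)) ∎)
    where open ≡-Reasoning

  -- Car c, preferring spot p, parks in its slot of the outcome σ.
  admissible : Fin n → Fin (spots y) → Bool
  admissible c p = fullFrom (toℕ p) (left c)

  parkCar-admissible : ∀ c p → admissible c p ≡ true →
                       parkCar (toℕ p) (y c) c (stage (toℕ c)) ≡ just (stage (suc (toℕ c)))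
  parkCar-admissible c p adm = begin
    parkCar (toℕ p) (y c) c (stage (toℕ c))
      ≡⟨ cong (parkCar (toℕ p) (y c) c) (stage-at c) ⟩
    parkCar (toℕ p) (y c) c (left c ++ gap (y c) ++ right c)
      ≡⟨ parkCar-fullFrom (toℕ p) (y⁺ c) c (left c) (right c) adm ⟩
    just (left c ++ block (y c) c ++ right c)
      ≡⟨ cong just (stage-suc c) ⟨
    just (stage (suc (toℕ c))) ∎
    where open ≡-Reasoning

  parkCar⇒admissible : ∀ c p {s'} → parkCar (toℕ p) (y c) c (stage (toℕ c)) ≡ just s' →
                       s' ⊑ blocks y order → admissible c p ≡ true
  parkCar⇒admissible c p {s'} h ext =
    parks-in-gap⇒fullFrom (toℕ p) (y⁺ c) c (left c) (right c) (blocks y (before c)) (blocks y (after c))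
      (subst (λ t → parkCar (toℕ p) (y c) c t ≡ just s') (stage-at c) h)
      (subst (s' ⊑_) (blocks-split c) ext)
      (trans (length-slots (toℕ c) (before c)) (sym (length-blocks y (before c))))
      (occ-blocks-∉ y (before c) c∉before)
      (occ-slots-∉ (toℕ c) (after c) c∉after)
      (occ-blocks-∉ y (after c) c∉after)
    where
    c∉before : All (c ≢_) (before c)
    c∉before = proj₁ (∉-before-after c)
    c∉after : All (c ≢_) (after c)
    c∉after = proj₂ (∉-before-after c)

  module Run (x : Vec (Fin (spots y)) n) where

    step : Maybe (Street n) → Fin n → Maybe (Street n)
    step ms c = ms >>= parkCar (toℕ (lookup x c)) (y c) c

    foldl-step-nothing : ∀ cs → foldl step nothing cs ≡ nothing
    foldl-step-nothing []       = refl
    foldl-step-nothing (_ ∷ cs) = foldl-step-nothing cs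

    run-∷⁻ : ∀ {s F} c cs → foldl step (just s) (c ∷ cs) ≡ just F →
             ∃ λ s' → parkCar (toℕ (lookup x c)) (y c) c s ≡ just s' × foldl step (just s') cs ≡ just F
    run-∷⁻ {s} c cs h with parkCar (toℕ (lookup x c)) (y c) c s
    ... | just s' = s' , refl , h
    ... | nothing with () ← trans (sym (foldl-step-nothing cs)) h

    run-⊑ : ∀ {s F} cs → foldl step (just s) cs ≡ just F → s ⊑ F
    run-⊑ []       refl = ⊑-refl _
    run-⊑ {s} (c ∷ cs) h with s' , park , h′ ← run-∷⁻ c cs h =
      ⊑-trans (parkCar-⊑ (toℕ (lookup x c)) (y c) c s park) (run-⊑ cs h′)

    run-admissible : (∀ c → admissible c (lookup x c) ≡ true) → ∀ {k cs} → CarsFrom n k cs →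
                     foldl step (just (stage k)) cs ≡ just (blocks y order)
    run-admissible adm (done n≤k)             = cong just (stage-complete n≤k)
    run-admissible adm (next {c = c} {cs} refl cars) =
      trans (cong (λ ms → foldl step ms cs) (parkCar-admissible c (lookup x c) (adm c)))
            (run-admissible adm cars)

    run-occ : ∀ {k cs s F} → CarsFrom n k cs → (∀ e → occ e s ≡ occ e (stage k)) →
              foldl step (just s) cs ≡ just F → ∀ e → occ e F ≡ occ e (blocks y order)
    run-occ (done n≤k)           s≈ refl e = trans (s≈ e) (cong (occ e) (stage-complete n≤k))
    run-occ (next {c = c} {cs} refl cars) s≈ h with s' , park , h′ ← run-∷⁻ c cs h =
      run-occ cars (occ-parkCar-stage c (toℕ (lookup x c)) park s≈) h′

    run⇒admissible : ∀ {k cs} → CarsFrom n k cs → foldl step (just (stage k)) cs ≡ just (blocks y order) →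
                     All (λ c → admissible c (lookup x c) ≡ true) cs
    run⇒admissible (done _) _ = []
    run⇒admissible (next {c = c} {cs} refl cars) h with s' , park , h′ ← run-∷⁻ c cs h
      with adm ← parkCar⇒admissible c (lookup x c) park (run-⊑ cs h′)
      with refl ← just-injective (trans (sym park) (parkCar-admissible c (lookup x c) adm)) =
      adm ∷ run⇒admissible cars h′

    outcome⇔admissible : outcome y x ≡ just (word σ) ⇔ (allCoordinates admissible x ≡ true)
    outcome⇔admissible = mk⇔ to from
      where
      to : outcome y x ≡ just (word σ) → allCoordinates admissible x ≡ true
      to h with F , parked , reads ← map-≡-just (parkAll y x) h = allCoordinates-complete admissible x
        (AllP.tabulate⁻ (run⇒admissible (allFin-CarsFrom n) (trans parked′ (cong just F≡))))
        where
        parked′ : foldl step (just (stage 0)) (allFin n) ≡ just F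
        parked′ = subst (λ s → foldl step (just s) (allFin n) ≡ just F) stage-empty parked
        F≡ : F ≡ blocks y order
        F≡ = compress⁻¹-blocks y nothing order F order-unique (All.universal (λ _ ()) order)
               (run-occ (allFin-CarsFrom n) (λ _ → refl) parked′) (trans reads word≡order)
      from : allCoordinates admissible x ≡ true → outcome y x ≡ just (word σ)
      from adm = begin
        Maybe.map (compress nothing) (parkAll y x)
          ≡⟨ cong (λ s → Maybe.map (compress nothing) (foldl step (just s) (allFin n))) stage-empty ⟩
        Maybe.map (compress nothing) (foldl step (just (stage 0)) (allFin n))
          ≡⟨ cong (Maybe.map (compress nothing))
                  (run-admissible (allCoordinates-sound admissible x adm) (allFin-CarsFrom n)) ⟩
        just (compress nothing (blocks y order))
          ≡⟨ cong just (compress-blocks y y⁺ nothing order order-unique (All.universal (λ _ ()) order)) ⟩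
        just order
          ≡⟨ cong just word≡order ⟨
        just (word σ) ∎
        where open ≡-Reasoning

  count-admissible : ∀ c → count (admissible c) (allFin (spots y)) ≡ factor (σ ⟨$⟩ˡ c)
  count-admissible c = trans (count-fullFrom (spots y) (left c) (length-left c)) (fullStarts-left c)

  fiberSize≡count-admissible : fiberSize y σ ≡ count (allCoordinates admissible) (allVecs (spots y) n)
  fiberSize≡count-admissible =
    trans (length-filter≡count _ (allVecs (spots y) n))
          (count-cong (λ x → does-⇔ (_ ≟ just (word σ)) (Run.outcome⇔admissible x)) (allVecs (spots y) n))
    where
    _≟_ : DecidableEquality (Maybe (List (Fin n)))
    _≟_ = MaybeP.≡-dec (LP.≡-dec FinP._≟_)

theorem1p1 : (n : ℕ) (y : Fin n → ℕ) → (∀ i → 1 ≤ y i) → (σ : Permutation′ n) →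
    fiberSize y σ ≡ productFormula y σ
theorem1p1 n y y⁺ σ = begin
  fiberSize y σ
    ≡⟨ fiberSize≡count-admissible ⟩
  count (allCoordinates admissible) (allVecs (spots y) n)
    ≡⟨ count-allCoordinates admissible ⟩
  product (map (λ c → count (admissible c) (allFin (spots y))) (allFin n))
    ≡⟨ cong product (LP.map-cong count-admissible (allFin n)) ⟩
  product (map (factor ∘ (flip σ ⟨$⟩ʳ_)) (allFin n))
    ≡⟨ product-permute factor (flip σ) ⟩
  productFormula y σ
    ∎
  where
  open ≡-Reasoning
  open Fibre y y⁺ σ
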